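{- If $G$ is a $C_{4k}$-free bipartite graph, then $\operatorname{Supp}(G)\cap\operatorname{Core}(G)=\emptyset$.
   Context: All graphs are finite, simple and undirected. A graph is a $C_{4k}$-free bipartite graph if it is bipartite and contains no cycle whose length is a multiple of $4$. For a graph $G$, $\operatorname{Null}(G)$ is the null space of its adjacency matrix, viewed as a subspace of $\mathbb{R}^{V(G)}$. $\operatorname{Supp}(G)$ is the set of vertices $v$ such that $\vec{x}_v\neq 0$ for some $\vec{x}\in\operatorname{Null}(G)$, and $\operatorname{Core}(G)$ is the set of vertices adjacent to at least one vertex of $\operatorname{Supp}(G)$.
   Formalization: The null space of the adjacency matrix, which defines $\operatorname{Supp}(G)$ and hence $\operatorname{Core}(G)$, is taken over ℚ instead of ℝ. -}

module Defs where

open import Data.Nat using (ℕ; zero; suc; _*_)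
open import Data.Fin using (Fin; zero; suc; fromℕ; inject₁)
open import Data.Bool using (Bool; true; false; if_then_else_)
open import Data.Rational using (ℚ; 0ℚ; 1ℚ) renaming (_+_ to _+ℚ_; _*_ to _*ℚ_)
open import Data.Product using (Σ; ∃; _×_)
open import Function.Definitions using (Injective)
open import Relation.Binary.PropositionalEquality using (_≡_; _≢_)
open import Relation.Nullary using (¬_)
open import Data.Empty using (⊥)

record Graph (n : ℕ) : Set where
  field
    adj   : Fin n → Fin n → Bool
    irrefl : ∀ v → adj v v ≡ false
    sym    : ∀ u v → adj u v ≡ adj v u

open Graph public

Edge : ∀ {n} → Graph n → Fin n → Fin n → Set
Edge G u v = adj G u v ≡ true

Bipartite : ∀ {n} → Graph n → Set
Bipartite {n} G = Σ (Fin n → Bool) λ c → ∀ u v → Edge G u v → c u ≢ c v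

sucMod : ∀ {m} → Fin (suc m) → Fin (suc m)
sucMod {zero} zero = zero
sucMod {suc m} zero = suc zero
sucMod {suc m} (suc i) with sucMod {m} i
... | zero = zero
... | suc j = suc (suc j)

-- A cycle of length L = suc m in G: an injective cyclic sequence of vertices
-- v_0, ..., v_m with v_i ~ v_{i+1 mod L}.  (Only used for L ≥ 4 below.)
Cycle : ∀ {n} → Graph n → ℕ → Set
Cycle {n} G zero = ⊥
Cycle {n} G (suc m) =
  Σ (Fin (suc m) → Fin n) λ f → Injective _≡_ _≡_ f × (∀ i → Edge G (f i) (f (sucMod i)))

C4kFree : ∀ {n} → Graph n → Set
C4kFree G = ∀ k → ¬ Cycle G (4 * suc k)

sumFin : ∀ {n} → (Fin n → ℚ) → ℚ
sumFin {zero} f = 0ℚ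
sumFin {suc n} f = f zero +ℚ sumFin (λ i → f (suc i))

A : ∀ {n} → Graph n → Fin n → Fin n → ℚ
A G u v = if adj G u v then 1ℚ else 0ℚ

InNull : ∀ {n} → Graph n → (Fin n → ℚ) → Set
InNull G x = ∀ u → sumFin (λ v → A G u v *ℚ x v) ≡ 0ℚ

Supp : ∀ {n} → Graph n → Fin n → Set
Supp G v = Σ (_ → ℚ) λ x → InNull G x × x v ≢ 0ℚ

Core : ∀ {n} → Graph n → Fin n → Set
Core {n} G v = Σ (Fin n) λ u → Edge G v u × Supp G u

{-# OPTIONS --safe #-}
module Submission where

open import Defs
open import Data.Nat using (ℕ)
open import Data.Fin using (Fin)
open import Data.Product using (_×_)
open import Relation.Nullary using (¬_)

open import Data.Bool using (Bool; true; false; not; if_then_else_; T)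
open import Data.Bool.Properties using (not-involutive; not-injective; not-¬; ¬-not)
  renaming (_≟_ to _≟𝔹_)
open import Data.Empty using (⊥; ⊥-elim)
open import Data.Fin using (zero; suc; toℕ)
open import Data.Fin.Properties using (toℕ-injective; toℕ<n; pigeonhole; any?)
  renaming (_≟_ to _≟Fin_)
open import Data.Nat using (zero; suc; _+_; _*_; _∸_; _%_; _/_; _<_; _≤_; z≤n; s≤s; NonZero)
open import Data.Nat.DivMod using (m≡m%n+[m/n]*n; m%n<n)
open import Data.Nat.Divisibility using (_∣_; divides; m%n≡0⇒n∣m)
open import Data.Nat.GeneralisedArithmetic using (fold)
open import Data.Nat.Induction using (<-rec)
open import Data.Nat.Properties
  using (+-assoc; +-comm; +-suc; *-comm; n<1+n; <-cmp; ≤-pred; m∸n+n≡m; +-monoˡ-≤; +-monoˡ-<; anyUpTo?)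
open import Data.Product using (∃-syntax; _,_; proj₁; proj₂; uncurry)
open import Data.Rational using (ℚ; 0ℚ; 1ℚ)
  renaming (_+_ to _+ℚ_; _*_ to _*ℚ_; _<_ to _<ℚ_; _≤_ to _≤ℚ_)
import Data.Rational.Properties as ℚ
open import Data.Sum using (_⊎_; inj₁; inj₂)
open import Data.Unit using (tt)
open import Function using (_∘_)
open import Relation.Binary.Definitions using (tri<; tri≈; tri>)
open import Relation.Binary.PropositionalEquality using (_≡_; _≢_; refl; trans; cong; cong₂; subst)
import Relation.Binary.PropositionalEquality as ≡
open import Relation.Nullary using (yes; no; ¬?; _×-dec_; contradiction)
open import Relation.Nullary.Decidable using (isYes; toWitness; toWitnessFalse)
open import Relation.Unary using (Pred; Decidable)

-- Idea: gluing a null vector that is nonzero at v (kept on the colour class of v) with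
-- one that is nonzero at a neighbour u (kept on the other class) gives a null vector z
-- with z v ≠ 0 ≠ z u.  As every row of A z vanishes, a vertex seeing a nonzero entry of
-- z also sees one of the opposite sign.  This yields an endless walk in the support of z
-- whose colour changes at every step and whose sign changes at every second step, so
-- the pair (colour, sign) along the walk has exact period 4.  Hence the walk revisits a
-- vertex only after a multiple of 4 steps, and its first repeated vertex closes a cycle
-- whose length is a multiple of 4.

sumFin-cong : ∀ {n} {f g : Fin n → ℚ} → (∀ i → f i ≡ g i) → sumFin f ≡ sumFin g
sumFin-cong {zero}  f≡g = refl
sumFin-cong {suc n} f≡g = cong₂ _+ℚ_ (f≡g zero) (sumFin-cong (f≡g ∘ suc))

sumFin-zero : ∀ {n} → sumFin {n} (λ _ → 0ℚ) ≡ 0ℚ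
sumFin-zero {zero}  = refl
sumFin-zero {suc n} = trans (cong (0ℚ +ℚ_) (sumFin-zero {n})) (ℚ.+-identityˡ 0ℚ)

sumFin-mono-≤ : ∀ {n} {f g : Fin n → ℚ} → (∀ i → f i ≤ℚ g i) → sumFin f ≤ℚ sumFin g
sumFin-mono-≤ {zero}  f≤g = ℚ.≤-refl
sumFin-mono-≤ {suc n} f≤g = ℚ.+-mono-≤ (f≤g zero) (sumFin-mono-≤ (f≤g ∘ suc))

sumFin-mono-< : ∀ {n} {f g : Fin n → ℚ} → (∀ i → f i ≤ℚ g i) →
                ∀ j → f j <ℚ g j → sumFin f <ℚ sumFin g
sumFin-mono-< f≤g zero    fj<gj = ℚ.+-mono-<-≤ fj<gj (sumFin-mono-≤ (f≤g ∘ suc))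
sumFin-mono-< f≤g (suc j) fj<gj = ℚ.+-mono-≤-< (f≤g zero) (sumFin-mono-< (f≤g ∘ suc) j fj<gj)

isPositive : ℚ → Bool
isPositive x = isYes (0ℚ ℚ.<? x)

isPositive⇒0< : ∀ {x} → isPositive x ≡ true → 0ℚ <ℚ x
isPositive⇒0< pos = toWitness (subst T (≡.sym pos) tt)

¬isPositive⇒<0 : ∀ {x} → isPositive x ≡ false → x ≢ 0ℚ → x <ℚ 0ℚ
¬isPositive⇒<0 {x} nonpos x≢0 with ℚ.<-cmp x 0ℚ
... | tri< x<0 _ _ = x<0
... | tri≈ _ x≡0 _ = contradiction x≡0 x≢0
... | tri> _ _ 0<x = contradiction 0<x (toWitnessFalse (subst (T ∘ not) (≡.sym nonpos) tt))

least-witness : ∀ {p} {Q : Pred ℕ p} → Decidable Q → ∀ j → Q j → ∃[ m ] Q m × (∀ {k} → k < m → ¬ Q k)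
least-witness {Q = Q} Q? = <-rec _ search
  where
  search : ∀ j → (∀ {k} → k < j → Q k → ∃[ m ] Q m × (∀ {k} → k < m → ¬ Q k)) →
           Q j → ∃[ m ] Q m × (∀ {k} → k < m → ¬ Q k)
  search j below qj with anyUpTo? Q? j
  ... | yes (k , k<j , qk) = below k<j qk
  ... | no none            = j , qj , λ k<j qk → none (_ , k<j , qk)

module _ {n} (f : ℕ → Fin n) where

  Repeat : ℕ → Set
  Repeat j = ∃[ i ] i < j × f i ≡ f j

  Repeat? : Decidable Repeat
  Repeat? j = anyUpTo? (λ i → f i ≟Fin f j) j

  repeat-by-pigeonhole : ∃[ j ] Repeat j
  repeat-by-pigeonhole with i , j , i<j , fi≡fj ← pigeonhole (n<1+n n) (f ∘ toℕ) =
    toℕ j , toℕ i , i<j , fi≡fj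

  first-repeat : ∃[ i ] ∃[ d ] f (suc d + i) ≡ f i × (∀ {a b} → a < b → b ≤ d → f (a + i) ≢ f (b + i))
  first-repeat with j , (i , i<j , fi≡fj) , first ← uncurry (least-witness Repeat?) repeat-by-pigeonhole
    = i , d , ≡.sym (trans fi≡fj (cong f (≡.sym j≡))) , distinct
    where
    d : ℕ
    d = j ∸ suc i

    j≡ : suc d + i ≡ j
    j≡ = trans (≡.sym (+-suc d i)) (m∸n+n≡m i<j)

    distinct : ∀ {a b} → a < b → b ≤ d → f (a + i) ≢ f (b + i)
    distinct {a} {b} a<b b≤d fa≡fb =
      first (subst (b + i <_) j≡ (+-monoˡ-≤ i (s≤s b≤d))) (a + i , +-monoˡ-< i a<b , fa≡fb)

toℕ-sucMod : ∀ {m} (t : Fin (suc m)) → (toℕ t ≡ m × toℕ (sucMod t) ≡ 0) ⊎ toℕ (sucMod t) ≡ suc (toℕ t)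
toℕ-sucMod {zero}  zero    = inj₁ (refl , refl)
toℕ-sucMod {suc m} zero    = inj₂ refl
toℕ-sucMod {suc m} (suc t) with sucMod t | toℕ-sucMod t
... | zero  | inj₁ (t≡m , _) = inj₁ (cong suc t≡m , refl)
... | suc _ | inj₂ next      = inj₂ (cong suc next)

module _ {a} {X : Set a} (h : ℕ → X) (m : ℕ) .{{_ : NonZero m}} (periodic : ∀ t → h (m + t) ≡ h t) where

  h[q*m+t]≡h[t] : ∀ q t → h (q * m + t) ≡ h t
  h[q*m+t]≡h[t] zero    t = refl
  h[q*m+t]≡h[t] (suc q) t =
    trans (cong h (+-assoc m (q * m) t)) (trans (periodic (q * m + t)) (h[q*m+t]≡h[t] q t))

  h[d%m+t]≡h[d+t] : ∀ d t → h (d % m + t) ≡ h (d + t)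
  h[d%m+t]≡h[d+t] d t = trans (≡.sym (h[q*m+t]≡h[t] (d / m) (d % m + t))) (cong h division)
    where
    division : d / m * m + (d % m + t) ≡ d + t
    division = trans (≡.sym (+-assoc (d / m * m) (d % m) t))
                     (cong (_+ t) (trans (+-comm (d / m * m) (d % m)) (≡.sym (m≡m%n+[m/n]*n d m))))

  h[d+t]≡h[t]⇒m∣d : (∀ {r} t → 0 < r → r < m → h (r + t) ≢ h t) → ∀ d t → h (d + t) ≡ h t → m ∣ d
  h[d+t]≡h[t]⇒m∣d fresh d t returns with d % m in d%m | h[d%m+t]≡h[d+t] d t
  ... | zero  | _       = m%n≡0⇒n∣m d m d%m
  ... | suc r | reduced =
    contradiction (trans reduced returns) (fresh t (s≤s z≤n) (subst (_< m) d%m (m%n<n d m)))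

antiperiodic⇒periodic : ∀ {b : ℕ → Bool} p → (∀ t → b (p + t) ≡ not (b t)) → ∀ t → b (p + (p + t)) ≡ b t
antiperiodic⇒periodic p anti t = trans (anti (p + t)) (trans (cong not (anti t)) (not-involutive _))

module _ {n} (G : Graph n) where

  ProperColouring : (Fin n → Bool) → Set
  ProperColouring c = ∀ u w → Edge G u w → c u ≢ c w

  Edge-sym : ∀ {u w} → Edge G u w → Edge G w u
  Edge-sym {u} {w} e = trans (Graph.sym G w u) e

  opposite-colour : ∀ {c} → ProperColouring c → ∀ {u w} → Edge G u w → c w ≡ not (c u)
  opposite-colour proper e = ¬-not (proper _ _ (Edge-sym e))

  recolour : Bipartite G → ∀ v → ∃[ c ] ProperColouring c × c v ≡ true
  recolour (c , proper) v with c v in cv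
  ... | true  = c , proper , cv
  ... | false = not ∘ c , (λ u w e → proper u w e ∘ not-injective) , cong not cv

  A*-edge : ∀ {p r} x → Edge G p r → A G p r *ℚ x ≡ x
  A*-edge x e rewrite e = ℚ.*-identityˡ x

  A*-cases : ∀ p r x → A G p r *ℚ x ≡ 0ℚ ⊎ (Edge G p r × A G p r *ℚ x ≡ x)
  A*-cases p r x with adj G p r
  ... | false = inj₁ (ℚ.*-zeroˡ x)
  ... | true  = inj₂ (refl , ℚ.*-identityˡ x)

  neighbourSum : Fin n → (Fin n → ℚ) → ℚ
  neighbourSum p x = sumFin (λ r → A G p r *ℚ x r)

  neighbourSum-cong : ∀ p {x y} → (∀ r → Edge G p r → x r ≡ y r) → neighbourSum p x ≡ neighbourSum p y
  neighbourSum-cong p {x} {y} x≡y = sumFin-cong termwise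
    where
    termwise : ∀ r → A G p r *ℚ x r ≡ A G p r *ℚ y r
    termwise r with adj G p r in e
    ... | false = trans (ℚ.*-zeroˡ (x r)) (≡.sym (ℚ.*-zeroˡ (y r)))
    ... | true  = cong (1ℚ *ℚ_) (x≡y r e)

  neighbourSum-pos : ∀ {p q x} → (∀ r → Edge G p r → 0ℚ ≤ℚ x r) →
                     Edge G p q → 0ℚ <ℚ x q → 0ℚ <ℚ neighbourSum p x
  neighbourSum-pos {p} {q} {x} nonneg pq 0<xq =
    subst (_<ℚ neighbourSum p x) (sumFin-zero {n})
      (sumFin-mono-< termwise q (subst (0ℚ <ℚ_) (≡.sym (A*-edge (x q) pq)) 0<xq))
    where
    termwise : ∀ r → 0ℚ ≤ℚ A G p r *ℚ x r
    termwise r with A*-cases p r (x r)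
    ... | inj₁ ≡0         = ℚ.≤-reflexive (≡.sym ≡0)
    ... | inj₂ (pr , ≡xr) = subst (0ℚ ≤ℚ_) (≡.sym ≡xr) (nonneg r pr)

  neighbourSum-neg : ∀ {p q x} → (∀ r → Edge G p r → x r ≤ℚ 0ℚ) →
                     Edge G p q → x q <ℚ 0ℚ → neighbourSum p x <ℚ 0ℚ
  neighbourSum-neg {p} {q} {x} nonpos pq xq<0 =
    subst (neighbourSum p x <ℚ_) (sumFin-zero {n})
      (sumFin-mono-< termwise q (subst (_<ℚ 0ℚ) (≡.sym (A*-edge (x q) pq)) xq<0))
    where
    termwise : ∀ r → A G p r *ℚ x r ≤ℚ 0ℚ
    termwise r with A*-cases p r (x r)
    ... | inj₁ ≡0         = ℚ.≤-reflexive ≡0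
    ... | inj₂ (pr , ≡xr) = subst (_≤ℚ 0ℚ) (≡.sym ≡xr) (nonpos r pr)

  glue : (Fin n → Bool) → (Fin n → ℚ) → (Fin n → ℚ) → Fin n → ℚ
  glue c x y q = if c q then x q else y q

  -- Row p of A only sees the colour class opposite to p, on which the glued vector is x or y alone.
  glue-null : ∀ {c x y} → ProperColouring c → InNull G x → InNull G y → InNull G (glue c x y)
  glue-null {c} {x} {y} proper x-null y-null p with c p in cp
  ... | true  = trans (neighbourSum-cong p λ r pr → cong (λ b → if b then x r else y r)
                                                         (trans (opposite-colour proper pr) (cong not cp)))
                      (y-null p)
  ... | false = trans (neighbourSum-cong p λ r pr → cong (λ b → if b then x r else y r)
                                                         (trans (opposite-colour proper pr) (cong not cp)))
                      (x-null p)

  common-null-vector : Bipartite G → ∀ {v u} → Edge G v u → Supp G v → Supp G u →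
                       ∃[ z ] InNull G z × z v ≢ 0ℚ × z u ≢ 0ℚ
  common-null-vector bip {v} {u} vu (x , x-null , xv≢0) (y , y-null , yu≢0)
    with c , proper , cv ← recolour bip v
    = glue c x y , glue-null proper x-null y-null , zv≢0 , zu≢0
    where
    cu : c u ≡ false
    cu = trans (opposite-colour proper vu) (cong not cv)

    zv≢0 : glue c x y v ≢ 0ℚ
    zv≢0 rewrite cv = xv≢0

    zu≢0 : glue c x y u ≢ 0ℚ
    zu≢0 rewrite cu = yu≢0

  opposite-sign-neighbour : ∀ {z p q} → InNull G z → Edge G p q → z q ≢ 0ℚ →
                            ∃[ r ] Edge G p r × z r ≢ 0ℚ × isPositive (z r) ≡ not (isPositive (z q))
  opposite-sign-neighbour {z} {p} {q} null pq zq≢0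
    with any? (λ r → (adj G p r ≟𝔹 true) ×-dec ¬? (z r ℚ.≟ 0ℚ) ×-dec (isPositive (z r) ≟𝔹 not (isPositive (z q))))
  ... | yes found = found
  ... | no none   = ⊥-elim (one-signed (isPositive (z q)) refl)
    where
    same-sign : ∀ {r} → Edge G p r → z r ≢ 0ℚ → isPositive (z r) ≡ isPositive (z q)
    same-sign pr zr≢0 = trans (¬-not λ opposite → none (_ , pr , zr≢0 , opposite)) (not-involutive _)

    one-signed : ∀ b → isPositive (z q) ≡ b → ⊥
    one-signed true pos = ℚ.<-irrefl (≡.sym (null p)) (neighbourSum-pos nonneg pq (isPositive⇒0< pos))
      where
      nonneg : ∀ r → Edge G p r → 0ℚ ≤ℚ z r
      nonneg r pr with z r ℚ.≟ 0ℚ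
      ... | yes zr≡0 = ℚ.≤-reflexive (≡.sym zr≡0)
      ... | no zr≢0  = ℚ.<⇒≤ (isPositive⇒0< (trans (same-sign pr zr≢0) pos))
    one-signed false neg = ℚ.<-irrefl (null p) (neighbourSum-neg nonpos pq (¬isPositive⇒<0 neg zq≢0))
      where
      nonpos : ∀ r → Edge G p r → z r ≤ℚ 0ℚ
      nonpos r pr with z r ℚ.≟ 0ℚ
      ... | yes zr≡0 = ℚ.≤-reflexive zr≡0
      ... | no zr≢0  = ℚ.<⇒≤ (¬isPositive⇒<0 (trans (same-sign pr zr≢0) neg) zr≢0)

  closedWalk⇒Cycle : (f : ℕ → Fin n) → (∀ t → Edge G (f t) (f (suc t))) → ∀ {m} →
                     f (suc m) ≡ f 0 → (∀ {a b} → a < b → b ≤ m → f a ≢ f b) → Cycle G (suc m)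
  closedWalk⇒Cycle f walk {m} closed distinct = f ∘ toℕ , injective , edges
    where
    injective : ∀ {s t} → f (toℕ s) ≡ f (toℕ t) → s ≡ t
    injective {s} {t} eq with <-cmp (toℕ s) (toℕ t)
    ... | tri< s<t _ _ = contradiction eq (distinct s<t (≤-pred (toℕ<n t)))
    ... | tri≈ _ s≡t _ = toℕ-injective s≡t
    ... | tri> _ _ t<s = contradiction (≡.sym eq) (distinct t<s (≤-pred (toℕ<n s)))

    edges : ∀ t → Edge G (f (toℕ t)) (f (toℕ (sucMod t)))
    edges t with toℕ-sucMod t
    ... | inj₁ (t≡m , wraps) = subst (Edge G _) (trans (cong (f ∘ suc) t≡m) (trans closed (cong f (≡.sym wraps))))
                                     (walk (toℕ t))
    ... | inj₂ next          = subst (Edge G _) (cong f (≡.sym next)) (walk (toℕ t))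

  walk⇒Cycle : (f : ℕ → Fin n) → (∀ t → Edge G (f t) (f (suc t))) → ∀ {m} →
               (∀ d t → f (d + t) ≡ f t → m ∣ d) → ∃[ k ] Cycle G (m * suc k)
  walk⇒Cycle f walk {m} returns with i , d , closed , distinct ← first-repeat f
    with returns (suc d) i closed
  ... | divides zero ()
  ... | divides (suc k) suc-d≡ =
    k , subst (Cycle G) (trans suc-d≡ (*-comm (suc k) m))
                        (closedWalk⇒Cycle (λ a → f (a + i)) (λ a → walk (a + i)) closed distinct)

  module _ {z} (null : InNull G z) where

    record SupportEdge : Set where
      field
        tail head : Fin n
        edge      : Edge G tail head
        tail≢0    : z tail ≢ 0ℚ
        head≢0    : z head ≢ 0ℚ
    open SupportEdge

    continuation : (s : SupportEdge) →
                   ∃[ r ] Edge G (head s) r × z r ≢ 0ℚ × isPositive (z r) ≡ not (isPositive (z (tail s)))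
    continuation s = opposite-sign-neighbour null (Edge-sym (edge s)) (tail≢0 s)

    advance : SupportEdge → SupportEdge
    advance s = record
      { tail   = head s
      ; head   = proj₁ (continuation s)
      ; edge   = proj₁ (proj₂ (continuation s))
      ; tail≢0 = head≢0 s
      ; head≢0 = proj₁ (proj₂ (proj₂ (continuation s)))
      }

    walk : SupportEdge → ℕ → Fin n
    walk s t = tail (fold s advance t)

    walk-edge : ∀ s t → Edge G (walk s t) (walk s (suc t))
    walk-edge s t = edge (fold s advance t)

    walk-sign : ∀ s t → isPositive (z (walk s (2 + t))) ≡ not (isPositive (z (walk s t)))
    walk-sign s t = proj₂ (proj₂ (proj₂ (continuation (fold s advance t))))

    walk-returns : ∀ {c} → ProperColouring c → ∀ s d t → walk s (d + t) ≡ walk s t → 4 ∣ d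
    walk-returns {c} proper s d t returns =
      h[d+t]≡h[t]⇒m∣d phase 4 period fresh d t (cong (λ p → c p , isPositive (z p)) returns)
      where
      colour sign : ℕ → Bool
      colour t = c (walk s t)
      sign   t = isPositive (z (walk s t))

      phase : ℕ → Bool × Bool
      phase t = colour t , sign t

      colour-flips : ∀ t → colour (1 + t) ≡ not (colour t)
      colour-flips t = opposite-colour proper (walk-edge s t)

      colour-2 : ∀ t → colour (2 + t) ≡ colour t
      colour-2 = antiperiodic⇒periodic 1 colour-flips

      period : ∀ t → phase (4 + t) ≡ phase t
      period t = cong₂ _,_ (trans (colour-2 (2 + t)) (colour-2 t)) (antiperiodic⇒periodic 2 (walk-sign s) t)

      fresh : ∀ {r} t → 0 < r → r < 4 → phase (r + t) ≢ phase t
      fresh {1} t _ _ eq = not-¬ (cong proj₁ eq) (colour-flips t)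
      fresh {2} t _ _ eq = not-¬ (cong proj₂ eq) (walk-sign s t)
      fresh {3} t _ _ eq = not-¬ (cong proj₁ eq) (trans (colour-flips (2 + t)) (cong not (colour-2 t)))
      fresh {suc (suc (suc (suc _)))} t _ (s≤s (s≤s (s≤s (s≤s ()))))

  nonzero-edge⇒C4k : Bipartite G → ∀ {z v u} → InNull G z → Edge G v u → z v ≢ 0ℚ → z u ≢ 0ℚ →
                     ∃[ k ] Cycle G (4 * suc k)
  nonzero-edge⇒C4k (_ , proper) {v = v} {u = u} null vu zv≢0 zu≢0 =
    walk⇒Cycle (walk null s) (walk-edge null s) (walk-returns null proper s)
    where
    s : SupportEdge null
    s = record { tail = v ; head = u ; edge = vu ; tail≢0 = zv≢0 ; head≢0 = zu≢0 }

corollary2p8 : ∀ {n : ℕ} (G : Graph n) → Bipartite G → C4kFree G →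
    ∀ (v : Fin n) → ¬ (Supp G v × Core G v)
corollary2p8 G bip C4k-free v (v∈Supp , u , vu , u∈Supp)
  with z , null , zv≢0 , zu≢0 ← common-null-vector G bip vu v∈Supp u∈Supp
  = uncurry C4k-free (nonzero-edge⇒C4k G bip null vu zv≢0 zu≢0)
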